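{- Let $G$ and $H$ be graphs such that $\left\lceil m(G)/2 \right\rceil < m(H)$. Then Breaker can win the $H$-game played on the edge set of $G$, even if Maker starts.
   Context: For a graph $G$, $m(G) := \max_{G' \subseteq G} \frac{e(G')}{v(G')}$, the maximum over nonempty subgraphs $G'$, where $e(G'),v(G')$ denote numbers of edges and vertices. In the $H$-game on $G$, Maker and Breaker alternately claim previously unclaimed edges of $G$ until all edges are claimed; Maker wins if his edges contain all edges of a copy of $H$, Breaker wins otherwise. -}

module Defs where

open import Data.Nat as ℕ using (ℕ; zero; suc; _<_; NonZero)
open import Data.Integer as ℤ using (ℤ; +_)
open import Data.Rational as ℚ using (ℚ; ½; ceiling)
open import Data.Bool using (Bool; true; false; T; _∧_)
open import Data.Fin as Fin using (Fin)
open import Data.List as List using (List; []; _∷_; filter; allFin; cartesianProduct; length)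
open import Data.List.Membership.Propositional using (_∈_)
open import Data.Vec as Vec using (Vec; removeAt; lookup)
open import Data.Product using (Σ; _×_; _,_)
open import Data.Sum using (_⊎_)
open import Data.Empty using (⊥)
open import Relation.Nullary using (¬_)
open import Relation.Nullary.Decidable using (does)
open import Relation.Binary.PropositionalEquality using (_≡_)
open import Function.Definitions using (Injective)

record Graph : Set where
  field
    n         : ℕ
    adj       : Fin n → Fin n → Bool
    adj-sym   : ∀ i j → adj i j ≡ adj j i
    adj-irrefl : ∀ i → adj i i ≡ false
open Graph public

-- Edges, each listed once as (i , j) with i < j.
Edge : ℕ → Set
Edge n = Fin n × Fin n

edgesOf : (n : ℕ) → (Fin n → Fin n → Bool) → List (Edge n)
edgesOf n a = filter (λ p → let (i , j) = p in
                 ( (i Fin.<? j) Relation.Nullary.Decidable.×-dec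
                   (Data.Bool._≟_ (a i j) true)))
              (cartesianProduct (allFin n) (allFin n))
  where import Data.Bool

edges : (G : Graph) → List (Edge (n G))
edges G = edgesOf (n G) (adj G)

count : ∀ {A : Set} → (A → Bool) → List A → ℕ
count p xs = length (filter (λ x → Data.Bool._≟_ (p x) true) xs)
  where import Data.Bool

record Subgraph (G : Graph) : Set where
  field
    vs       : Fin (n G) → Bool
    es       : Fin (n G) → Fin (n G) → Bool
    es-sym   : ∀ i j → es i j ≡ es j i
    es-⊆     : ∀ i j → T (es i j) → T (adj G i j ∧ (vs i ∧ vs j))
open Subgraph public

vcount : {G : Graph} → Subgraph G → ℕ
vcount {G} S = count (vs S) (allFin (n G))

ecount : {G : Graph} → Subgraph G → ℕ
ecount {G} S = length (edgesOf (n G) (es S))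

density : {G : Graph} → (S : Subgraph G) → .{{NonZero (vcount S)}} → ℚ
density S = (+ ecount S) ℚ./ vcount S

-- "q = m(G)": q is the maximum of e(G')/v(G') over nonempty subgraphs G' ⊆ G.
IsMaxDensity : Graph → ℚ → Set
IsMaxDensity G q =
  Σ (Subgraph G) (λ S → Σ (NonZero (vcount S)) (λ nz → density S {{nz}} ≡ q))
  × (∀ (S : Subgraph G) (nz : NonZero (vcount S)) → density S {{nz}} ℚ.≤ q)

ContainsCopy : (H G : Graph) → List (Edge (n G)) → Set
ContainsCopy H G M =
  Σ (Fin (n H) → Fin (n G)) λ φ →
    Injective _≡_ _≡_ φ ×
    (∀ u v → T (adj H u v) → ((φ u , φ v) ∈ M) ⊎ ((φ v , φ u) ∈ M))

-- The H-game on the edge set of G.  U = unclaimed edges (k of them),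
-- M = edges claimed by Maker so far.  Breaker's claimed edges play no role
-- other than being removed from U.
mutual
  BreakerWinsM : (H G : Graph) → (k : ℕ) → Vec (Edge (n G)) k → List (Edge (n G)) → Set
  BreakerWinsM H G zero    U M = ¬ ContainsCopy H G M
  BreakerWinsM H G (suc k) U M =
    (i : Fin (suc k)) → BreakerWinsB H G k (removeAt U i) (lookup U i ∷ M)

  BreakerWinsB : (H G : Graph) → (k : ℕ) → Vec (Edge (n G)) k → List (Edge (n G)) → Set
  BreakerWinsB H G zero    U M = ¬ ContainsCopy H G M
  BreakerWinsB H G (suc k) U M =
    Σ (Fin (suc k)) λ i → BreakerWinsM H G k (removeAt U i) M

BreakerWinsMakerFirst : (H G : Graph) → Set
BreakerWinsMakerFirst H G =
  BreakerWinsM H G (length (edges G)) (Vec.fromList (edges G)) []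

-- Let c = ⌈m(G)/2⌉.  Every nonempty subgraph S of G has e(S) ≤ 2c·v(S), so by Hakimi's theorem
-- G has an orientation with all out-degrees at most 2c.  Pairing up the out-edges of each vertex
-- splits E(G) into blocks of at most two edges, each block owned by one of its endpoints and each
-- vertex owning at most c blocks.  Breaker answers every edge of Maker with the other edge of its
-- block, so Maker ends with at most one edge per block.  Charging each of Maker's edges to its
-- block shows that every subgraph of Maker's graph has at most c edges per vertex, whereas a copy
-- of H would contain a subgraph with e/v = m(H) > c.

module Submission where

open import Defs

module Counting where

  open import Data.Nat using (ℕ; zero; suc; _+_; _*_; _≤_; _<_; z≤n)
  open import Data.Nat.Properties
  open import Data.Fin as Fin using (Fin; zero; suc; punchIn)
  import Data.Fin.Properties as FinP
  open FinP using (punchInᵢ≢i)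
  open import Data.Bool as Bool using (Bool; true; false; _∧_)
  open import Data.List as List using (List; _++_; length; filter; tabulate; allFin; cartesianProduct)
  import Data.List.Properties as List
  open import Data.List.Membership.Propositional using (_∈_)
  open import Data.List.Membership.Propositional.Properties using (∈-filter⁻)
  open import Data.List.Relation.Unary.Unique.Propositional using (Unique)
  import Data.List.Relation.Unary.Unique.Propositional.Properties as Unique
  open import Data.Vec.Functional using (Vector)
  open import Data.Product using (_×_; _,_; proj₁; proj₂)
  open import Function using (_∘_)
  open import Relation.Nullary using (does)
  open import Relation.Nullary.Decidable using (dec-true; dec-false; _×-dec_)
  open import Relation.Unary using (Pred; Decidable)
  open import Relation.Binary using (tri<; tri≈; tri>)
  open import Relation.Binary.PropositionalEquality
  open import Algebra.Properties.Semiring.Sum +-*-semiring public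
    using (sum; sum-syntax; sum-remove; sum-cong-≗; ∑-distrib-+; ∑-comm; *-distribˡ-sum; sum-replicate-zero)

  ⟦_⟧ : Bool → ℕ
  ⟦ true ⟧  = 1
  ⟦ false ⟧ = 0

  ⟦⟧≤1 : ∀ b → ⟦ b ⟧ ≤ 1
  ⟦⟧≤1 true  = ≤-refl
  ⟦⟧≤1 false = z≤n

  does-≟-true : ∀ b → does (b Bool.≟ true) ≡ b
  does-≟-true true  = refl
  does-≟-true false = refl

  sum-mono-≤ : ∀ {n} {f g : Vector ℕ n} → (∀ i → f i ≤ g i) → sum f ≤ sum g
  sum-mono-≤ {zero}  _   = z≤n
  sum-mono-≤ {suc n} f≤g = +-mono-≤ (f≤g zero) (sum-mono-≤ (f≤g ∘ suc))

  sum-mono-< : ∀ {n} {f g : Vector ℕ n} i → (∀ j → f j ≤ g j) → f i < g i → sum f < sum g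
  sum-mono-< {suc _} {f} {g} i f≤g fᵢ<gᵢ =
    subst₂ _<_ (sym (sum-remove {i = i} f)) (sym (sum-remove {i = i} g))
      (+-mono-<-≤ fᵢ<gᵢ (sum-mono-≤ (f≤g ∘ punchIn i)))

  ≤-sum : ∀ {n} (f : Vector ℕ n) i → f i ≤ sum f
  ≤-sum {suc _} f i = subst (f i ≤_) (sym (sum-remove {i = i} f)) (m≤m+n _ _)

  -- Changing one summand: both sides equal  f i + g i + ∑_{j ≠ i} f j.
  sum-update : ∀ {n} (f g : Vector ℕ n) i → (∀ j → j ≢ i → f j ≡ g j) →
               sum f + g i ≡ sum g + f i
  sum-update {suc _} f g i agree = begin
    sum f + g i                            ≡⟨ cong (_+ g i) (sum-remove {i = i} f) ⟩
    f i + sum (f ∘ punchIn i) + g i        ≡⟨ cong (λ s → f i + s + g i) rest ⟩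
    f i + sum (g ∘ punchIn i) + g i        ≡⟨ +-comm (f i + _) (g i) ⟩
    g i + (f i + sum (g ∘ punchIn i))      ≡⟨ cong (g i +_) (+-comm (f i) _) ⟩
    g i + (sum (g ∘ punchIn i) + f i)      ≡⟨ +-assoc (g i) _ (f i) ⟨
    g i + sum (g ∘ punchIn i) + f i        ≡⟨ cong (_+ f i) (sum-remove {i = i} g) ⟨
    sum g + f i                            ∎
    where
    open ≡-Reasoning
    rest : sum (f ∘ punchIn i) ≡ sum (g ∘ punchIn i)
    rest = sum-cong-≗ (λ j → agree (punchIn i j) (punchInᵢ≢i i j))

  module _ {a p} {A : Set a} {P : Pred A p} (P? : Decidable P) where

    length-filter-tabulate : ∀ {n} (f : Fin n → A) →
      length (filter P? (tabulate f)) ≡ ∑[ i < n ] ⟦ does (P? (f i)) ⟧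
    length-filter-tabulate {zero}  f = refl
    length-filter-tabulate {suc n} f with does (P? (f zero))
    ... | true  = cong suc (length-filter-tabulate (f ∘ suc))
    ... | false = length-filter-tabulate (f ∘ suc)

  length-filter-cartesianProduct :
    ∀ {a b p} {A : Set a} {B : Set b} {P : Pred (A × B) p} (P? : Decidable P) {m n} (f : Fin m → A) (g : Fin n → B) →
    length (filter P? (cartesianProduct (tabulate f) (tabulate g))) ≡ ∑[ i < m ] ∑[ j < n ] ⟦ does (P? (f i , g j)) ⟧
  length-filter-cartesianProduct P? {zero}  f g = refl
  length-filter-cartesianProduct P? {suc m} f g = begin
    length (filter P? (row ++ rows))                 ≡⟨ cong length (List.filter-++ P? row rows) ⟩
    length (filter P? row ++ filter P? rows)         ≡⟨ List.length-++ (filter P? row) ⟩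
    length (filter P? row) + length (filter P? rows) ≡⟨ cong₂ _+_ rowCount (length-filter-cartesianProduct P? (f ∘ suc) g) ⟩
    _                                                ∎
    where
    open ≡-Reasoning
    row   = List.map (f zero ,_) (tabulate g)
    rows  = cartesianProduct (tabulate (f ∘ suc)) (tabulate g)
    rowCount = trans (cong (length ∘ filter P?) (List.map-tabulate g (f zero ,_)))
                     (length-filter-tabulate P? (λ j → f zero , g j))

  count-allFin : ∀ n (q : Fin n → Bool) → count q (allFin n) ≡ ∑[ i < n ] ⟦ q i ⟧
  count-allFin n q = trans (length-filter-tabulate (λ i → q i Bool.≟ true) (λ i → i))
                           (sum-cong-≗ (λ i → cong ⟦_⟧ (does-≟-true (q i))))

  private
    isEdge? : ∀ {n} (p : Fin n → Fin n → Bool) →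
              Decidable (λ (e : Fin n × Fin n) → proj₁ e Fin.< proj₂ e × p (proj₁ e) (proj₂ e) ≡ true)
    isEdge? p e = (proj₁ e Fin.<? proj₂ e) ×-dec (p (proj₁ e) (proj₂ e) Bool.≟ true)

  -- For an adjacency relation: the degree sum, twice the number of edges.
  pairCount : (n : ℕ) → (Fin n → Fin n → Bool) → ℕ
  pairCount n p = ∑[ i < n ] ∑[ j < n ] ⟦ p i j ⟧

  module _ {n : ℕ} (p : Fin n → Fin n → Bool)
           (p-sym : ∀ i j → p i j ≡ p j i) (p-irrefl : ∀ i → p i i ≡ false) where

    private
      upper : Fin n → Fin n → ℕ
      upper i j = ⟦ does (i Fin.<? j) ∧ p i j ⟧

      upper+lower : ∀ i j → upper i j + upper j i ≡ ⟦ p i j ⟧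
      upper+lower i j with FinP.<-cmp i j
      ... | tri< i<j _ j≮i rewrite dec-true (i Fin.<? j) i<j | dec-false (j Fin.<? i) j≮i = +-identityʳ _
      ... | tri≈ i≮i refl _ rewrite dec-false (i Fin.<? i) i≮i | p-irrefl i = refl
      ... | tri> i≮j _ j<i rewrite dec-false (i Fin.<? j) i≮j | dec-true (j Fin.<? i) j<i = cong ⟦_⟧ (p-sym j i)

    handshake : 2 * length (edgesOf n p) ≡ pairCount n p
    handshake = begin
      2 * length (edgesOf n p)                                ≡⟨ cong (2 *_) lengthEq ⟩
      2 * U                                                   ≡⟨ cong (U +_) (+-identityʳ U) ⟩
      U + ∑[ i < n ] ∑[ j < n ] upper i j                     ≡⟨ cong (U +_) (∑-comm upper) ⟩
      U + ∑[ j < n ] ∑[ i < n ] upper i j                     ≡⟨ ∑-distrib-+ (λ i → ∑[ j < n ] upper i j) (λ i → ∑[ j < n ] upper j i) ⟨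
      ∑[ i < n ] (∑[ j < n ] upper i j + ∑[ j < n ] upper j i) ≡⟨ sum-cong-≗ (λ i → ∑-distrib-+ (upper i) (λ j → upper j i)) ⟨
      ∑[ i < n ] ∑[ j < n ] (upper i j + upper j i)           ≡⟨ sum-cong-≗ (λ i → sum-cong-≗ (upper+lower i)) ⟩
      pairCount n p                                           ∎
      where
      open ≡-Reasoning
      U = ∑[ i < n ] ∑[ j < n ] upper i j
      lengthEq : length (edgesOf n p) ≡ U
      lengthEq = trans (length-filter-cartesianProduct (isEdge? p) (λ i → i) (λ j → j))
                       (sum-cong-≗ (λ i → sum-cong-≗ (λ j → cong (λ b → ⟦ does (i Fin.<? j) ∧ b ⟧)
                                                                   (does-≟-true (p i j)))))

  edgesOf-ordered : ∀ n (p : Fin n → Fin n → Bool) {i j} → (i , j) ∈ edgesOf n p → i Fin.< j × p i j ≡ true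
  edgesOf-ordered n p = proj₂ ∘ ∈-filter⁻ (isEdge? p) {xs = cartesianProduct (allFin n) (allFin n)}

  edgesOf-unique : ∀ n (p : Fin n → Fin n → Bool) → Unique (edgesOf n p)
  edgesOf-unique n p = Unique.filter⁺ _ (Unique.cartesianProduct⁺ (Unique.allFin⁺ n) (Unique.allFin⁺ n))

module Density where

  open import Data.Nat as ℕ using (ℕ; suc; NonZero)
  open import Data.Integer as ℤ using (ℤ; +_; -[1+_])
  import Data.Integer.Properties as ℤ
  import Data.Integer.DivMod as ℤ using (a≡a%n+[a/n]*n; _%_)
  open import Data.Integer.Solver using (module +-*-Solver)
  open import Data.Rational as ℚ using (ℚ; ↥_; ↧_; ↧ₙ_; _/_; ½; floor; ceiling; toℚᵘ)
  import Data.Rational.Properties as ℚ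
  open import Data.Rational.Unnormalised as ℚᵘ using (_≃_; *≡*)
  import Data.Rational.Unnormalised.Properties as ℚᵘ
  open import Data.Product using (Σ; ∃; _×_; _,_)
  open import Relation.Binary.PropositionalEquality

  toℚᵘ-/ : ∀ i n .{{_ : NonZero n}} → toℚᵘ (i / n) ≃ i ℚᵘ./ n
  toℚᵘ-/ i (suc n) = ℚ.toℚᵘ-fromℚᵘ (i ℚᵘ./ suc n)

  ↥-/-cross : ∀ i n .{{_ : NonZero n}} → ↥ (i / n) ℤ.* + n ≡ i ℤ.* ↧ (i / n)
  ↥-/-cross i n@(suc _) with toℚᵘ-/ i n
  ... | *≡* eq = subst₂ (λ a b → a ℤ.* + n ≡ i ℤ.* b) (ℚ.↥ᵘ-toℚᵘ (i / n)) (ℚ.↧ᵘ-toℚᵘ (i / n)) eq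

  /-cancel-≤ : ∀ i m j n .{{_ : NonZero m}} .{{_ : NonZero n}} → i / m ℚ.≤ j / n → i ℤ.* + n ℤ.≤ j ℤ.* + m
  /-cancel-≤ i m@(suc _) j n@(suc _) p≤q
    with ℚᵘ.≤-respʳ-≃ (toℚᵘ-/ j n) (ℚᵘ.≤-respˡ-≃ (toℚᵘ-/ i m) (ℚ.toℚᵘ-mono-≤ p≤q))
  ... | ℚᵘ.*≤* ineq = ineq

  /-cancel-< : ∀ i m j n .{{_ : NonZero m}} .{{_ : NonZero n}} → i / m ℚ.< j / n → i ℤ.* + n ℤ.< j ℤ.* + m
  /-cancel-< i m@(suc _) j n@(suc _) p<q
    with ℚᵘ.<-respʳ-≃ (toℚᵘ-/ j n) (ℚᵘ.<-respˡ-≃ (toℚᵘ-/ i m) (ℚ.toℚᵘ-mono-< p<q))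
  ... | ℚᵘ.*<* ineq = ineq

  floor*↧≤↥ : ∀ p → floor p ℤ.* ↧ p ℤ.≤ ↥ p
  floor*↧≤↥ p@record{} = subst (floor p ℤ.* ↧ p ℤ.≤_) (sym (ℤ.a≡a%n+[a/n]*n (↥ p) (↧ p)))
                               (ℤ.i≤j⇒i≤k+j (+ (↥ p ℤ.% ↧ p)) ℤ.≤-refl)

  ↥≤ceiling*↧ : ∀ p → ↥ p ℤ.≤ ceiling p ℤ.* ↧ p
  ↥≤ceiling*↧ p@record{} = subst₂ ℤ._≤_
    (trans (cong ℤ.-_ (ℚ.↥-neg p)) (ℤ.neg-involutive (↥ p)))
    (trans (ℤ.neg-distribˡ-* (floor (ℚ.- p)) (↧ (ℚ.- p))) (cong (ceiling p ℤ.*_) (ℚ.↧-neg p)))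
    (ℤ.neg-mono-≤ (floor*↧≤↥ (ℚ.- p)))

  -- p ≤ 2 ⌈p / 2⌉, cross-multiplied.
  ↥≤2*ceiling-half*↧ : ∀ p → ↥ p ℤ.≤ ceiling (p ℚ.* ½) ℤ.* + 2 ℤ.* ↧ p
  ↥≤2*ceiling-half*↧ p@record{} = ℤ.*-cancelʳ-≤-pos (↥ p) (c ℤ.* + 2 ℤ.* ↧ p) (↧ q) (begin
    ↥ p ℤ.* ↧ q            ≡⟨ cong (ℤ._* ↧ q) (ℤ.*-identityʳ (↥ p)) ⟨
    ↥ p ℤ.* + 1 ℤ.* ↧ q    ≡⟨ ↥-/-cross (↥ p ℤ.* + 1) (↧ₙ p ℕ.* 2) ⟨
    ↥ q ℤ.* + A            ≤⟨ ℤ.*-monoʳ-≤-nonNeg (+ A) (↥≤ceiling*↧ q) ⟩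
    c ℤ.* ↧ q ℤ.* + A      ≡⟨ cong (λ a → c ℤ.* ↧ q ℤ.* a) (ℤ.pos-* (↧ₙ p) 2) ⟩
    c ℤ.* ↧ q ℤ.* (↧ p ℤ.* + 2) ≡⟨ solve 3 (λ c d e → c :* d :* (e :* con (+ 2)) := c :* con (+ 2) :* e :* d)
                                          refl c (↧ q) (↧ p) ⟩
    c ℤ.* + 2 ℤ.* ↧ p ℤ.* ↧ q ∎)
    where
    open ℤ.≤-Reasoning
    open +-*-Solver
    q : ℚ
    q = p ℚ.* ½
    A : ℕ
    A = ↧ₙ p ℕ.* 2
    c : ℤ
    c = ceiling q

  ratio≤-cross : ∀ e v .{{_ : NonZero v}} p k → (+ e) / v ℚ.≤ p → ↥ p ℤ.≤ k ℤ.* ↧ p → + e ℤ.≤ k ℤ.* + v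
  ratio≤-cross e v p k e/v≤p ↥p≤k↧p = ℤ.*-cancelʳ-≤-pos (+ e) (k ℤ.* + v) (↧ p) (begin
    + e ℤ.* ↧ p          ≤⟨ /-cancel-≤ (+ e) v (↥ p) (↧ₙ p) (subst ((+ e) / v ℚ.≤_) (sym (ℚ.↥p/↧p≡p p)) e/v≤p) ⟩
    ↥ p ℤ.* + v          ≤⟨ ℤ.*-monoʳ-≤-nonNeg (+ v) ↥p≤k↧p ⟩
    k ℤ.* ↧ p ℤ.* + v    ≡⟨ solve 3 (λ k d v → k :* d :* v := k :* v :* d) refl k (↧ p) (+ v) ⟩
    k ℤ.* + v ℤ.* ↧ p    ∎)
    where
    open ℤ.≤-Reasoning
    open +-*-Solver

  private
    -- for negative z the bound z * 2 * v is negative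
    nonNegative-of-≤ : ∀ e v .{{_ : NonZero v}} z → + e ℤ.≤ z ℤ.* + 2 ℤ.* + v → ∃ λ c → z ≡ + c
    nonNegative-of-≤ e v (+ c) _ = c , refl
    nonNegative-of-≤ e (suc v) -[1+ k ] ()

    ecount≤2⌈m/2⌉*vcount : ∀ {G m} → IsMaxDensity G m → (S : Subgraph G) (nz : NonZero (vcount S)) →
                            + ecount S ℤ.≤ ceiling (m ℚ.* ½) ℤ.* + 2 ℤ.* + vcount S
    ecount≤2⌈m/2⌉*vcount {m = m} (_ , maximal) S nz =
      ratio≤-cross (ecount S) (vcount S) {{nz}} m (ceiling (m ℚ.* ½) ℤ.* + 2) (maximal S nz) (↥≤2*ceiling-half*↧ m)

  maxDensity⇒sparse : ∀ {G m} → IsMaxDensity G m →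
    ∃ λ c → ceiling (m ℚ.* ½) ≡ + c × (∀ (S : Subgraph G) → NonZero (vcount S) → ecount S ℕ.≤ 2 ℕ.* c ℕ.* vcount S)
  maxDensity⇒sparse {G} {m} isMax@((S₀ , nz₀ , _) , _)
    with nonNegative-of-≤ (ecount S₀) (vcount S₀) {{nz₀}} _ (ecount≤2⌈m/2⌉*vcount isMax S₀ nz₀)
  ... | c , ceiling≡c = c , ceiling≡c , λ S nz →
    ℤ.drop‿+≤+ (subst (+ ecount S ℤ.≤_) (bound≡ S) (ecount≤2⌈m/2⌉*vcount isMax S nz))
    where
    bound≡ : ∀ (S : Subgraph G) → ceiling (m ℚ.* ½) ℤ.* + 2 ℤ.* + vcount S ≡ + (2 ℕ.* c ℕ.* vcount S)
    bound≡ S = begin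
      ceiling (m ℚ.* ½) ℤ.* + 2 ℤ.* + vcount S ≡⟨ cong (λ z → z ℤ.* + 2 ℤ.* + vcount S) ceiling≡c ⟩
      + c ℤ.* + 2 ℤ.* + vcount S               ≡⟨ cong (ℤ._* + vcount S) (trans (ℤ.*-comm (+ c) (+ 2)) (sym (ℤ.pos-* 2 c))) ⟩
      + (2 ℕ.* c) ℤ.* + vcount S               ≡⟨ ℤ.pos-* (2 ℕ.* c) (vcount S) ⟨
      + (2 ℕ.* c ℕ.* vcount S)                 ∎
      where open ≡-Reasoning

  maxDensity⇒dense : ∀ {H m} c → IsMaxDensity H m → (+ c) / 1 ℚ.< m →
    Σ (Subgraph H) λ S → c ℕ.* vcount S ℕ.< ecount S
  maxDensity⇒dense c ((S , nz , density≡m) , _) c<m =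
    S , ℤ.drop‿+<+ (subst₂ ℤ._<_ (sym (ℤ.pos-* c (vcount S))) (ℤ.*-identityʳ (+ ecount S))
                     (/-cancel-< (+ c) 1 (+ ecount S) (vcount S) {{_}} {{nz}}
                                 (subst ((+ c) / 1 ℚ.<_) (sym density≡m) c<m)))

module Orientation where

  open Counting
  open import Data.Nat using (ℕ; zero; suc; _+_; _*_; _≤_; _<_; z≤n; s≤s)
  open import Data.Nat.Properties
  import Data.Fin.Properties as FinP
  open import Data.Fin as Fin using (Fin)
  open import Data.Bool as Bool using (Bool; true; false; _∧_; _∨_; not; if_then_else_)
  import Data.Bool.Properties as Bool
  open import Data.List as List using (List; []; _∷_; allFin; cartesianProduct)
  open import Data.List.Membership.Propositional using (_∈_)
  open import Data.List.Membership.Propositional.Properties using (∈-cartesianProduct⁺; ∈-allFin)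
  open import Data.List.Relation.Unary.Any using (here; there)
  open import Data.Product using (Σ; _×_; _,_; proj₁; proj₂)
  open import Data.Product.Properties using (≡-dec; ,-injectiveˡ; ,-injectiveʳ)
  open import Data.Sum using (_⊎_; inj₁; inj₂)
  open import Data.Empty using (⊥; ⊥-elim)
  open import Function using (_∘_; case_of_)
  open import Relation.Nullary using (Dec; yes; no; does)
  open import Relation.Nullary.Decidable using (dec-true; _×-dec_)
  open import Relation.Binary.PropositionalEquality

  -- w i j = true encodes an arc i → j.
  Arcs : ℕ → Set
  Arcs n = Fin n → Fin n → Bool

  outdeg : ∀ {n} → Arcs n → Fin n → ℕ
  outdeg {n} w i = ∑[ j < n ] ⟦ w i j ⟧

  covers : ∀ {n} → Arcs n → Fin n → Fin n → Bool
  covers w i j = w i j ∨ w j i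

  _≟²_ : ∀ {n} (e f : Fin n × Fin n) → Dec (e ≡ f)
  _≟²_ = ≡-dec Fin._≟_ Fin._≟_

  _[_↦_] : ∀ {n} → Arcs n → Fin n × Fin n → Bool → Arcs n
  (w [ e ↦ v ]) x y = if does ((x , y) ≟² e) then v else w x y

  module _ {n} (w : Arcs n) (e : Fin n × Fin n) (v : Bool) where

    update-≡ : (w [ e ↦ v ]) (proj₁ e) (proj₂ e) ≡ v
    update-≡ with e ≟² e
    ... | yes _ = refl
    ... | no e≢e = ⊥-elim (e≢e refl)

    update-≢ : ∀ {x y} → (x , y) ≢ e → (w [ e ↦ v ]) x y ≡ w x y
    update-≢ {x} {y} ne with (x , y) ≟² e
    ... | yes eq = ⊥-elim (ne eq)
    ... | no _ = refl

    update-cases : ∀ x y → (x , y) ≡ e ⊎ ((x , y) ≢ e × (w [ e ↦ v ]) x y ≡ w x y)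
    update-cases x y with (x , y) ≟² e
    ... | yes eq = inj₁ eq
    ... | no ne  = inj₂ (ne , refl)

    outdeg-update-≡ : outdeg (w [ e ↦ v ]) (proj₁ e) + ⟦ w (proj₁ e) (proj₂ e) ⟧ ≡ outdeg w (proj₁ e) + ⟦ v ⟧
    outdeg-update-≡ = trans (sum-update (λ y → ⟦ (w [ e ↦ v ]) a y ⟧) (λ y → ⟦ w a y ⟧) b
                                        (λ y y≢b → cong ⟦_⟧ (update-≢ {a} {y} (y≢b ∘ ,-injectiveʳ))))
                            (cong (λ z → outdeg w a + ⟦ z ⟧) update-≡)
      where
      a b : Fin n
      a = proj₁ e
      b = proj₂ e

    outdeg-update-≢ : ∀ {x} → x ≢ proj₁ e → outdeg (w [ e ↦ v ]) x ≡ outdeg w x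
    outdeg-update-≢ {x} x≢a = sum-cong-≗ (λ y → cong ⟦_⟧ (update-≢ {x} {y} (x≢a ∘ ,-injectiveˡ)))

  private
    ∨-introˡ : ∀ {a} b → a ≡ true → a ∨ b ≡ true
    ∨-introˡ _ refl = refl

    ∨-introʳ : ∀ a {b} → b ≡ true → a ∨ b ≡ true
    ∨-introʳ true  _ = refl
    ∨-introʳ false e = e

    ∨-elim : ∀ a b → a ∨ b ≡ true → a ≡ true ⊎ b ≡ true
    ∨-elim true  _ _ = inj₁ refl
    ∨-elim false _ e = inj₂ e

    false≢true : false ≢ true
    false≢true ()

  #outside : ∀ {N} → (Fin N → Bool) → ℕ
  #outside {N} S = ∑[ i < N ] ⟦ not (S i) ⟧

  insert : ∀ {N} → Fin N → (Fin N → Bool) → (Fin N → Bool)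
  insert t S x = S x ∨ does (x Fin.≟ t)

  module _ {N} (t : Fin N) (S : Fin N → Bool) where

    ∈-insert : insert t S t ≡ true
    ∈-insert = ∨-introʳ (S t) (dec-true (t Fin.≟ t) refl)

    ⊆-insert : ∀ {x} → S x ≡ true → insert t S x ≡ true
    ⊆-insert {x} = ∨-introˡ (does (x Fin.≟ t))

    ∈-insert⁻ : ∀ {x} → insert t S x ≡ true → S x ≡ true ⊎ x ≡ t
    ∈-insert⁻ {x} x∈ with S x | x Fin.≟ t
    ... | true  | _        = inj₁ refl
    ... | false | yes x≡t  = inj₂ x≡t
    ... | false | no _     = ⊥-elim (false≢true x∈)

    #outside-insert : S t ≡ false → #outside (insert t S) < #outside S
    #outside-insert t∉S = sum-mono-< t (λ x → not-∨ (S x) _) t-now-inside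
      where
      not-∨ : ∀ a b → ⟦ not (a ∨ b) ⟧ ≤ ⟦ not a ⟧
      not-∨ true  _     = z≤n
      not-∨ false true  = z≤n
      not-∨ false false = ≤-refl
      t-now-inside : ⟦ not (insert t S t) ⟧ < ⟦ not (S t) ⟧
      t-now-inside rewrite t∉S | dec-true (t Fin.≟ t) refl = s≤s z≤n

  #outside≤ : ∀ {N} (S : Fin N → Bool) → #outside S ≤ N
  #outside≤ {N} S = ≤-trans (sum-mono-≤ (λ i → ⟦⟧≤1 (not (S i)))) (≤-reflexive (sum-ones N))
    where
    sum-ones : ∀ n → ∑[ i < n ] 1 ≡ n
    sum-ones zero    = refl
    sum-ones (suc n) = cong suc (sum-ones n)

  -- Hakimi's theorem: a graph in which every vertex set R spans at most K |R| edges has an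
  -- orientation with all out-degrees at most K.  Edges are oriented one at a time; an edge uv that
  -- cannot be oriented directly is made room for by reversing a directed path from u or v to a vertex
  -- of out-degree < K.  If there is no such path, the vertices reachable from u and v all have
  -- out-degree K and, with the edge uv, span more than K times as many edges as vertices.
  module Hakimi (N : ℕ) (adj : Arcs N)
                (adj-sym : ∀ i j → adj i j ≡ adj j i) (adj-irrefl : ∀ i → adj i i ≡ false)
                (K : ℕ)
                (sparse : ∀ (R : Fin N → Bool) u → R u ≡ true →
                          pairCount N (λ i j → adj i j ∧ R i ∧ R j) ≤ 2 * (K * ∑[ i < N ] ⟦ R i ⟧)) where

    record IsOrientation (w : Arcs N) : Set where
      field
        arc⇒adj  : ∀ {i j} → w i j ≡ true → adj i j ≡ true
        arc-asym : ∀ {i j} → w i j ≡ true → w j i ≡ false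
        outdeg≤K : ∀ i → outdeg w i ≤ K
    open IsOrientation

    adj⇒≢ : ∀ {i j} → adj i j ≡ true → i ≢ j
    adj⇒≢ {i} a refl = false≢true (trans (sym (adj-irrefl i)) a)

    empty-isOrientation : IsOrientation (λ _ _ → false)
    empty-isOrientation = record
      { arc⇒adj = λ ()
      ; arc-asym = λ ()
      ; outdeg≤K = λ _ → ≤-trans (≤-reflexive (sum-replicate-zero N)) z≤n }

    reverse : Arcs N → Fin N → Fin N → Arcs N
    reverse w s t = (w [ (s , t) ↦ false ]) [ (t , s) ↦ true ]

    module Reverse {w} (o : IsOrientation w) {s t} (st : w s t ≡ true) (t-low : outdeg w t < K) where

      private
        w₁ : Arcs N
        w₁ = w [ (s , t) ↦ false ]
        s≢t : s ≢ t
        s≢t = adj⇒≢ (arc⇒adj o st)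
        st≢ts : (s , t) ≢ (t , s)
        st≢ts = s≢t ∘ ,-injectiveˡ

      w′ : Arcs N
      w′ = reverse w s t

      cases : ∀ x y → (x , y) ≡ (s , t) ⊎ (x , y) ≡ (t , s) ⊎
                      ((x , y) ≢ (s , t) × (x , y) ≢ (t , s) × w′ x y ≡ w x y)
      cases x y with update-cases w₁ (t , s) true x y
      ... | inj₁ eq = inj₂ (inj₁ eq)
      ... | inj₂ (≢ts , eq₁) with update-cases w (s , t) false x y
      ...   | inj₁ eq = inj₁ eq
      ...   | inj₂ (≢st , eq₂) = inj₂ (inj₂ (≢st , ≢ts , trans eq₁ eq₂))

      w′-st : w′ s t ≡ false
      w′-st = trans (update-≢ w₁ (t , s) true st≢ts) (update-≡ w (s , t) false)

      w′-ts : w′ t s ≡ true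
      w′-ts = update-≡ w₁ (t , s) true

      outdeg-s : outdeg w′ s + 1 ≡ outdeg w s
      outdeg-s = begin
        outdeg w′ s + 1          ≡⟨ cong (_+ 1) (outdeg-update-≢ w₁ (t , s) true s≢t) ⟩
        outdeg w₁ s + 1          ≡⟨ cong (λ b → outdeg w₁ s + ⟦ b ⟧) st ⟨
        outdeg w₁ s + ⟦ w s t ⟧  ≡⟨ outdeg-update-≡ w (s , t) false ⟩
        outdeg w s + 0           ≡⟨ +-identityʳ _ ⟩
        outdeg w s               ∎
        where open ≡-Reasoning

      outdeg-t : outdeg w′ t ≡ outdeg w t + 1
      outdeg-t = begin
        outdeg w′ t                 ≡⟨ +-identityʳ _ ⟨
        outdeg w′ t + 0             ≡⟨ cong (λ b → outdeg w′ t + ⟦ b ⟧) w₁-ts ⟨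
        outdeg w′ t + ⟦ w₁ t s ⟧    ≡⟨ outdeg-update-≡ w₁ (t , s) true ⟩
        outdeg w₁ t + 1             ≡⟨ cong (_+ 1) (outdeg-update-≢ w (s , t) false (s≢t ∘ sym)) ⟩
        outdeg w t + 1              ∎
        where
        open ≡-Reasoning
        w₁-ts : w₁ t s ≡ false
        w₁-ts = trans (update-≢ w (s , t) false (st≢ts ∘ sym)) (arc-asym o st)

      outdeg-other : ∀ {x} → x ≢ s → x ≢ t → outdeg w′ x ≡ outdeg w x
      outdeg-other x≢s x≢t = trans (outdeg-update-≢ w₁ (t , s) true x≢t) (outdeg-update-≢ w (s , t) false x≢s)

      isOrientation : IsOrientation w′
      arc⇒adj isOrientation {x} {y} xy with cases x y
      ... | inj₁ refl = ⊥-elim (false≢true (trans (sym w′-st) xy))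
      ... | inj₂ (inj₁ refl) = trans (adj-sym t s) (arc⇒adj o st)
      ... | inj₂ (inj₂ (_ , _ , eq)) = arc⇒adj o (trans (sym eq) xy)
      arc-asym isOrientation {x} {y} xy with cases x y | cases y x
      ... | inj₁ refl | _ = ⊥-elim (false≢true (trans (sym w′-st) xy))
      ... | inj₂ (inj₁ refl) | _ = w′-st
      ... | inj₂ (inj₂ (_ , ≢ts , _)) | inj₁ refl = ⊥-elim (≢ts refl)
      ... | inj₂ (inj₂ (≢st , _ , _)) | inj₂ (inj₁ refl) = ⊥-elim (≢st refl)
      ... | inj₂ (inj₂ (_ , _ , eq)) | inj₂ (inj₂ (_ , _ , eq′)) = trans eq′ (arc-asym o (trans (sym eq) xy))
      outdeg≤K isOrientation x = case ((x Fin.≟ s) , (x Fin.≟ t)) of λ where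
        (yes refl , _) → ≤-trans (m≤m+n _ 1) (≤-trans (≤-reflexive outdeg-s) (outdeg≤K o x))
        (no _ , yes refl) → ≤-trans (≤-reflexive (trans outdeg-t (+-comm _ 1))) t-low
        (no x≢s , no x≢t) → ≤-trans (≤-reflexive (outdeg-other x≢s x≢t)) (outdeg≤K o x)

      covers-reverse : ∀ x y → covers w′ x y ≡ covers w x y
      covers-reverse x y with cases x y | cases y x
      ... | inj₁ refl | _ rewrite w′-st | w′-ts | st = refl
      ... | inj₂ (inj₁ refl) | _ rewrite w′-st | w′-ts | st = sym (Bool.∨-zeroʳ _)
      ... | inj₂ (inj₂ (_ , ≢ts , _)) | inj₁ refl = ⊥-elim (≢ts refl)
      ... | inj₂ (inj₂ (≢st , _ , _)) | inj₂ (inj₁ refl) = ⊥-elim (≢st refl)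
      ... | inj₂ (inj₂ (_ , _ , eq)) | inj₂ (inj₂ (_ , _ , eq′)) = cong₂ _∨_ eq eq′

    module AddArc {w} (o : IsOrientation w) {a b} (ab : adj a b ≡ true)
                  (no-ab : w a b ≡ false) (no-ba : w b a ≡ false) (a-low : outdeg w a < K) where

      w′ : Arcs N
      w′ = w [ (a , b) ↦ true ]

      w′-ab : w′ a b ≡ true
      w′-ab = update-≡ w (a , b) true

      outdeg-a : outdeg w′ a ≡ outdeg w a + 1
      outdeg-a = trans (sym (+-identityʳ _))
                       (trans (cong (λ z → outdeg w′ a + ⟦ z ⟧) (sym no-ab)) (outdeg-update-≡ w (a , b) true))

      isOrientation : IsOrientation w′
      arc⇒adj isOrientation {x} {y} xy with update-cases w (a , b) true x y
      ... | inj₁ refl = ab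
      ... | inj₂ (_ , eq) = arc⇒adj o (trans (sym eq) xy)
      arc-asym isOrientation {x} {y} xy with update-cases w (a , b) true x y | update-cases w (a , b) true y x
      ... | inj₁ refl | inj₁ ba≡ab = ⊥-elim (adj⇒≢ ab (,-injectiveʳ ba≡ab))
      ... | inj₁ refl | inj₂ (_ , eq′) = trans eq′ no-ba
      ... | inj₂ (_ , eq) | inj₁ refl = ⊥-elim (false≢true (trans (sym no-ba) (trans (sym eq) xy)))
      ... | inj₂ (_ , eq) | inj₂ (_ , eq′) = trans eq′ (arc-asym o (trans (sym eq) xy))
      outdeg≤K isOrientation x = case x Fin.≟ a of λ where
        (yes refl) → ≤-trans (≤-reflexive (trans outdeg-a (+-comm _ 1))) a-low
        (no x≢a) → ≤-trans (≤-reflexive (outdeg-update-≢ w (a , b) true x≢a)) (outdeg≤K o x)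

      arc-mono : ∀ {x y} → w x y ≡ true → w′ x y ≡ true
      arc-mono {x} {y} xy with update-cases w (a , b) true x y
      ... | inj₁ refl = w′-ab
      ... | inj₂ (_ , eq) = trans eq xy

      covers-mono : ∀ {x y} → covers w x y ≡ true → covers w′ x y ≡ true
      covers-mono {x} {y} c with ∨-elim (w x y) (w y x) c
      ... | inj₁ xy = ∨-introˡ (w′ y x) (arc-mono xy)
      ... | inj₂ yx = ∨-introʳ (w′ x y) (arc-mono yx)

    -- Either a vertex of S can lose an arc (by reversing a path from it to a vertex of out-degree
    -- < K, which leaves arcs inside S alone), or S lies in a closed set of saturated vertices.
    data Augmentation (w : Arcs N) (S : Fin N → Bool) : Set where
      augmented : ∀ w′ → IsOrientation w′ → (∀ x y → covers w′ x y ≡ covers w x y) →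
                  (∀ i j → S i ≡ true → S j ≡ true → w′ i j ≡ w i j) →
                  ∀ s → S s ≡ true → outdeg w′ s < K → Augmentation w S
      blocked : (R : Fin N → Bool) → (∀ x → S x ≡ true → R x ≡ true) → (∀ x → R x ≡ true → K ≤ outdeg w x) →
                (∀ x y → R x ≡ true → w x y ≡ true → R y ≡ true) → Augmentation w S

    data Frontier (w : Arcs N) (S : Fin N → Bool) : Set where
      unsaturated : ∀ s → S s ≡ true → outdeg w s < K → Frontier w S
      closed : (∀ x → S x ≡ true → K ≤ outdeg w x) → (∀ x y → S x ≡ true → w x y ≡ true → S y ≡ true) →
               Frontier w S
      exit : ∀ s t → S s ≡ true → S t ≡ false → w s t ≡ true → Frontier w S

    frontier : ∀ w S → Frontier w S
    frontier w S with FinP.any? (λ s → (S s Bool.≟ true) ×-dec (outdeg w s <? K))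
    ... | yes (s , s∈S , s-low) = unsaturated s s∈S s-low
    ... | no none-low
      with FinP.any? (λ s → FinP.any? (λ t → (S s Bool.≟ true) ×-dec ((S t Bool.≟ false) ×-dec (w s t Bool.≟ true))))
    ...   | yes (s , t , s∈S , t∉S , st) = exit s t s∈S t∉S st
    ...   | no no-exit = closed (λ x x∈S → ≮⇒≥ (λ x-low → none-low (x , x∈S , x-low))) closure
      where
      closure : ∀ x y → S x ≡ true → w x y ≡ true → S y ≡ true
      closure x y x∈S xy with S y in y∈S
      ... | true  = refl
      ... | false = ⊥-elim (no-exit (x , y , x∈S , y∈S , xy))

    augment : ∀ fuel {w} → IsOrientation w → ∀ S → #outside S ≤ fuel → Augmentation w S
    augment fuel {w} o S fuel-ok with frontier w S
    ... | unsaturated s s∈S s-low = augmented w o (λ _ _ → refl) (λ _ _ _ _ → refl) s s∈S s-low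
    ... | closed saturated closure = blocked S (λ _ x∈S → x∈S) saturated closure
    augment zero    o S fuel-ok | exit s t s∈S t∉S st =
      ⊥-elim (<⇒≱ (≤-<-trans z≤n (#outside-insert t S t∉S)) fuel-ok)
    augment (suc fuel) {w} o S fuel-ok | exit s t s∈S t∉S st
      with augment fuel o (insert t S) (≤-pred (≤-trans (#outside-insert t S t∉S) fuel-ok))
    ... | blocked R ⊇S saturated closure = blocked R (λ x x∈S → ⊇S x (⊆-insert t S x∈S)) saturated closure
    ... | augmented w′ o′ same-covers same-inside s′ s′∈S′ s′-low with ∈-insert⁻ t S s′∈S′
    ...   | inj₁ s′∈S = augmented w′ o′ same-covers
                                (λ i j i∈S j∈S → same-inside i j (⊆-insert t S i∈S) (⊆-insert t S j∈S)) s′ s′∈S s′-low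
    ...   | inj₂ refl = augmented R.w′ R.isOrientation (λ x y → trans (R.covers-reverse x y) (same-covers x y))
                              unchanged s s∈S s-low
      where
      -- The free vertex is the new vertex t: pass its spare capacity back to s by reversing s → t.
      w′-st : w′ s t ≡ true
      w′-st = trans (same-inside s t (⊆-insert t S s∈S) (∈-insert t S)) st
      module R = Reverse o′ w′-st s′-low
      unchanged : ∀ i j → S i ≡ true → S j ≡ true → R.w′ i j ≡ w i j
      unchanged i j i∈S j∈S with R.cases i j
      ... | inj₁ refl = ⊥-elim (false≢true (trans (sym t∉S) j∈S))
      ... | inj₂ (inj₁ refl) = ⊥-elim (false≢true (trans (sym t∉S) i∈S))
      ... | inj₂ (inj₂ (_ , _ , eq)) = trans eq (same-inside i j (⊆-insert t S i∈S) (⊆-insert t S j∈S))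
      s-low : outdeg R.w′ s < K
      s-low = ≤-trans (≤-reflexive (trans (+-comm 1 _) R.outdeg-s)) (outdeg≤K o′ s)

    private
      arcs≤edge : ∀ (a b x y z : Bool) → (x ≡ true → y ≡ false) → (x ≡ true → z ≡ true) → (y ≡ true → z ≡ true) →
                  ⟦ a ∧ b ∧ x ⟧ + ⟦ b ∧ a ∧ y ⟧ ≤ ⟦ z ∧ a ∧ b ⟧
      arcs≤edge false false _     _     _ _  _   _   = z≤n
      arcs≤edge false true  _     _     _ _  _   _   = z≤n
      arcs≤edge true  false _     _     _ _  _   _   = z≤n
      arcs≤edge true  true  true  true  _ as _   _   = ⊥-elim (false≢true (sym (as refl)))
      arcs≤edge true  true  true  false z _  x⇒z _   rewrite x⇒z refl = ≤-refl
      arcs≤edge true  true  false true  z _  _   y⇒z rewrite y⇒z refl = ≤-refl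
      arcs≤edge true  true  false false _ _  _   _   = z≤n

    -- A closed set R of saturated vertices spans at least K |R| arcs, i.e. 2 K |R| in pairCount;
    -- an unoriented edge uv inside R makes that count strictly larger, contradicting sparseness.
    closed-saturated-impossible :
      ∀ {w} → IsOrientation w → ∀ {u v} → adj u v ≡ true → w u v ≡ false → w v u ≡ false →
      (R : Fin N → Bool) → R u ≡ true → R v ≡ true → (∀ x → R x ≡ true → K ≤ outdeg w x) →
      (∀ x y → R x ≡ true → w x y ≡ true → R y ≡ true) → ⊥
    closed-saturated-impossible {w} o {u} {v} uv no-uv no-vu R u∈R v∈R saturated closure =
      <⇒≱ (begin-strict
        T + T                                          ≡⟨ both-directions ⟩
        ∑[ r < N ] ∑[ t < N ] (arc r t + arc t r)      <⟨ sum-mono-< u (λ r → sum-mono-≤ (pointwise r))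
                                                                       (sum-mono-< v (pointwise u) uv-unoriented) ⟩
        pairCount N edge                               ≤⟨ sparse R u u∈R ⟩
        2 * (K * ∑[ i < N ] ⟦ R i ⟧)                   ≤⟨ *-monoʳ-≤ 2 K|R|≤T ⟩
        2 * T                                          ∎)
        (≤-reflexive (cong (T +_) (+-identityʳ T)))
      where
      open ≤-Reasoning
      arc : Fin N → Fin N → ℕ
      arc r t = ⟦ R r ∧ R t ∧ w r t ⟧
      edge : Fin N → Fin N → Bool
      edge r t = adj r t ∧ R r ∧ R t
      T : ℕ
      T = ∑[ r < N ] ∑[ t < N ] arc r t

      both-directions : T + T ≡ ∑[ r < N ] ∑[ t < N ] (arc r t + arc t r)
      both-directions = sym (trans (sum-cong-≗ (λ r → ∑-distrib-+ (arc r) (λ t → arc t r)))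
                                   (trans (∑-distrib-+ (λ r → ∑[ t < N ] arc r t) (λ r → ∑[ t < N ] arc t r))
                                          (cong (T +_) (sym (∑-comm arc)))))

      pointwise : ∀ r t → arc r t + arc t r ≤ ⟦ edge r t ⟧
      pointwise r t = arcs≤edge (R r) (R t) (w r t) (w t r) (adj r t) (arc-asym o) (arc⇒adj o)
                                (λ tr → trans (adj-sym r t) (arc⇒adj o tr))

      uv-unoriented : arc u v + arc v u < ⟦ edge u v ⟧
      uv-unoriented rewrite u∈R | v∈R | no-uv | no-vu | uv = s≤s z≤n

      row : ∀ r → K * ⟦ R r ⟧ ≤ ∑[ t < N ] arc r t
      row r with R r in r∈R
      ... | false = ≤-trans (≤-reflexive (*-zeroʳ K)) z≤n
      ... | true  = ≤-trans (≤-reflexive (*-identityʳ K))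
                            (≤-trans (saturated r r∈R) (≤-reflexive (sum-cong-≗ arc-inside)))
        where
        arc-inside : ∀ t → ⟦ w r t ⟧ ≡ ⟦ R t ∧ w r t ⟧
        arc-inside t with w r t in rt
        ... | true  rewrite closure r t r∈R rt = refl
        ... | false rewrite Bool.∧-zeroʳ (R t) = refl

      K|R|≤T : K * ∑[ i < N ] ⟦ R i ⟧ ≤ T
      K|R|≤T = ≤-trans (≤-reflexive (*-distribˡ-sum K (λ i → ⟦ R i ⟧))) (sum-mono-≤ row)

    private
      pair : Fin N → Fin N → (Fin N → Bool)
      pair u v = insert v (insert u (λ _ → false))

      u∈pair : ∀ u v → pair u v u ≡ true
      u∈pair u v = ⊆-insert v (insert u (λ _ → false)) {u} (∈-insert u (λ _ → false))

      v∈pair : ∀ u v → pair u v v ≡ true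
      v∈pair u v = ∈-insert v (insert u (λ _ → false))

      ∈-pair : ∀ {u v s} → pair u v s ≡ true → s ≡ u ⊎ s ≡ v
      ∈-pair {u} {v} {s} s∈ with s Fin.≟ u | s Fin.≟ v
      ... | yes s≡u | _     = inj₁ s≡u
      ... | no _    | yes s≡v = inj₂ s≡v

      add-arc : ∀ {w} → IsOrientation w → ∀ {a b} → adj a b ≡ true → w a b ≡ false → w b a ≡ false →
                outdeg w a < K →
                Σ (Arcs N) λ w′ → IsOrientation w′ × (∀ {i j} → covers w i j ≡ true → covers w′ i j ≡ true) ×
                                  covers w′ a b ≡ true
      add-arc o ab no-ab no-ba a-low = A.w′ , A.isOrientation , A.covers-mono , ∨-introˡ _ A.w′-ab
        where module A = AddArc o ab no-ab no-ba a-low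

    orient-edge : ∀ {w} → IsOrientation w → ∀ {u v} → adj u v ≡ true →
      Σ (Arcs N) λ w′ → IsOrientation w′ × (∀ {i j} → covers w i j ≡ true → covers w′ i j ≡ true) × covers w′ u v ≡ true
    orient-edge {w} o {u} {v} uv with w u v in uv-arc | w v u in vu-arc
    ... | true  | _    = w , o , (λ c → c) , ∨-introˡ (w v u) uv-arc
    ... | false | true = w , o , (λ c → c) , ∨-introʳ (w u v) vu-arc
    ... | false | false = make-room (augment N o (pair u v) (#outside≤ (pair u v)))
      where
      Result : Set
      Result = Σ (Arcs N) λ w′ → IsOrientation w′ × (∀ {i j} → covers w i j ≡ true → covers w′ i j ≡ true) ×
                                 covers w′ u v ≡ true

      make-room : Augmentation w (pair u v) → Result
      make-room (blocked R ⊇pair saturated closure) =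
        ⊥-elim (closed-saturated-impossible o uv uv-arc vu-arc R (⊇pair u (u∈pair u v)) (⊇pair v (v∈pair u v))
                                            saturated closure)
      make-room (augmented w′ o′ same-covers same-inside s s∈pair s-low) = orient-from (∈-pair {u} {v} {s} s∈pair)
        where
        no-uv : w′ u v ≡ false
        no-uv = trans (same-inside u v (u∈pair u v) (v∈pair u v)) uv-arc
        no-vu : w′ v u ≡ false
        no-vu = trans (same-inside v u (v∈pair u v) (u∈pair u v)) vu-arc

        orient-from : s ≡ u ⊎ s ≡ v → Result
        orient-from (inj₁ refl) with add-arc o′ uv no-uv no-vu s-low
        ... | w″ , o″ , mono , cov = w″ , o″ , (λ c → mono (trans (same-covers _ _) c)) , cov
        orient-from (inj₂ refl) with add-arc o′ (trans (adj-sym v u) uv) no-vu no-uv s-low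
        ... | w″ , o″ , mono , cov = w″ , o″ , (λ c → mono (trans (same-covers _ _) c)) ,
                                     trans (Bool.∨-comm (w″ u v) (w″ v u)) cov

    private
      orient-all : ∀ (L : List (Fin N × Fin N)) →
        Σ (Arcs N) λ w → IsOrientation w × (∀ {i j} → (i , j) ∈ L → adj i j ≡ true → covers w i j ≡ true)
      orient-all [] = (λ _ _ → false) , empty-isOrientation , λ ()
      orient-all ((u , v) ∷ L) with orient-all L | adj u v in uv
      ... | w , o , cov | false = w , o , λ where
        (here refl) uv′ → ⊥-elim (false≢true (trans (sym uv) uv′))
        (there ij∈L) → cov ij∈L
      ... | w , o , cov | true with orient-edge o uv
      ...   | w′ , o′ , mono , uv-covered = w′ , o′ , λ where
        (here refl) _ → uv-covered
        (there ij∈L) ij → mono (cov ij∈L ij)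

    orientation : Σ (Arcs N) λ w → IsOrientation w × (∀ i j → adj i j ≡ true → covers w i j ≡ true)
    orientation with orient-all (cartesianProduct (allFin N) (allFin N))
    ... | w , o , cov = w , o , λ i j → cov (∈-cartesianProduct⁺ (∈-allFin i) (∈-allFin j))

module Pairing where

  open Counting
  open Orientation using (Arcs; outdeg; covers)
  open import Data.Nat using (ℕ; _+_; _*_; _≤_; _<_; z≤n; s≤s)
  open import Data.Nat.Properties
  open import Data.Nat.DivMod using (_/_; _%_; m≡m%n+[m/n]*n; m%n<n; m<n*o⇒m/o<n)
  open import Data.Fin as Fin using (Fin)
  import Data.Fin.Properties as FinP
  open import Data.Bool as Bool using (true; false; _∧_; if_then_else_)
  open import Data.Product using (_×_; _,_; proj₁; proj₂; swap)
  open import Data.Product.Properties using (,-injectiveˡ; ,-injectiveʳ)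
  open import Data.Sum using (_⊎_; inj₁; inj₂)
  open import Data.Empty using (⊥-elim)
  open import Relation.Nullary using (yes; no; does)
  open import Relation.Nullary.Decidable using (dec-true; dec-false)
  open import Relation.Binary using (tri<; tri≈; tri>)
  open import Relation.Binary.PropositionalEquality
  open import Function using (_∘_)

  private
    ≤1-pigeonhole : ∀ {x y z} → x ≤ 1 → y ≤ 1 → z ≤ 1 → x ≢ y → x ≢ z → y ≡ z
    ≤1-pigeonhole z≤n       z≤n       _         x≢y _   = ⊥-elim (x≢y refl)
    ≤1-pigeonhole z≤n       (s≤s z≤n) z≤n       _   x≢z = ⊥-elim (x≢z refl)
    ≤1-pigeonhole z≤n       (s≤s z≤n) (s≤s z≤n) _   _   = refl
    ≤1-pigeonhole (s≤s z≤n) z≤n       z≤n       _   _   = refl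
    ≤1-pigeonhole (s≤s z≤n) z≤n       (s≤s z≤n) _   x≢z = ⊥-elim (x≢z refl)
    ≤1-pigeonhole (s≤s z≤n) (s≤s z≤n) _         x≢y _   = ⊥-elim (x≢y refl)

    %2≤1 : ∀ a → a % 2 ≤ 1
    %2≤1 a = ≤-pred (m%n<n a 2)

    ≡-from-/2-%2 : ∀ {a b} → a / 2 ≡ b / 2 → a % 2 ≡ b % 2 → a ≡ b
    ≡-from-/2-%2 {a} {b} q r =
      trans (m≡m%n+[m/n]*n a 2) (trans (cong₂ (λ x y → x + y * 2) r q) (sym (m≡m%n+[m/n]*n b 2)))

  /2-at-most-two : ∀ {a b d} → a / 2 ≡ b / 2 → a / 2 ≡ d / 2 → a ≢ b → a ≢ d → b ≡ d
  /2-at-most-two {a} {b} {d} ab ad a≢b a≢d = ≡-from-/2-%2 (trans (sym ab) ad)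
    (≤1-pigeonhole (%2≤1 a) (%2≤1 b) (%2≤1 d) (a≢b ∘ ≡-from-/2-%2 ab) (a≢d ∘ ≡-from-/2-%2 ad))

  -- The out-neighbours of each vertex are numbered 0, 1, 2, … in increasing order and paired up
  -- as {0,1}, {2,3}, …; each pair (together with its tail) is a block.
  module Blocks {N : ℕ} (w : Arcs N) where

    rank : Fin N → Fin N → ℕ
    rank x t = ∑[ y < N ] ⟦ w x y ∧ does (y Fin.<? t) ⟧

    rank-< : ∀ {x t t′} → w x t ≡ true → t Fin.< t′ → rank x t < rank x t′
    rank-< {x} {t} {t′} xt t<t′ = sum-mono-< t below (begin-strict
        ⟦ w x t ∧ does (t Fin.<? t) ⟧   ≡⟨ cong₂ (λ a b → ⟦ a ∧ b ⟧) xt (dec-false (t Fin.<? t) (FinP.<-irrefl refl)) ⟩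
        0                                <⟨ s≤s z≤n ⟩
        1                                ≡⟨ cong₂ (λ a b → ⟦ a ∧ b ⟧) xt (dec-true (t Fin.<? t′) t<t′) ⟨
        ⟦ w x t ∧ does (t Fin.<? t′) ⟧  ∎)
      where
      open ≤-Reasoning
      below : ∀ y → ⟦ w x y ∧ does (y Fin.<? t) ⟧ ≤ ⟦ w x y ∧ does (y Fin.<? t′) ⟧
      below y with w x y
      ... | false = z≤n
      ... | true with y Fin.<? t
      ...   | no y≮t rewrite dec-false (y Fin.<? t) y≮t = z≤n
      ...   | yes y<t rewrite dec-true (y Fin.<? t) y<t | dec-true (y Fin.<? t′) (FinP.<-trans y<t t<t′) = ≤-refl

    rank-injective : ∀ {x t t′} → w x t ≡ true → w x t′ ≡ true → rank x t ≡ rank x t′ → t ≡ t′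
    rank-injective {x} {t} {t′} xt xt′ eq with FinP.<-cmp t t′
    ... | tri< t<t′ _ _ = ⊥-elim (<-irrefl eq (rank-< xt t<t′))
    ... | tri≈ _ t≡t′ _ = t≡t′
    ... | tri> _ _ t′<t = ⊥-elim (<-irrefl (sym eq) (rank-< xt′ t′<t))

    rank<outdeg : ∀ {x t} → w x t ≡ true → rank x t < outdeg w x
    rank<outdeg {x} {t} xt = sum-mono-< t (λ y → ∧-≤ (w x y) _) (begin-strict
        ⟦ w x t ∧ does (t Fin.<? t) ⟧   ≡⟨ cong₂ (λ a b → ⟦ a ∧ b ⟧) xt (dec-false (t Fin.<? t) (FinP.<-irrefl refl)) ⟩
        0                                <⟨ s≤s z≤n ⟩
        ⟦ true ⟧                          ≡⟨ cong ⟦_⟧ xt ⟨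
        ⟦ w x t ⟧                         ∎)
      where
      open ≤-Reasoning
      ∧-≤ : ∀ a b → ⟦ a ∧ b ⟧ ≤ ⟦ a ⟧
      ∧-≤ false _     = z≤n
      ∧-≤ true  false = z≤n
      ∧-≤ true  true  = ≤-refl

    arc : Edge N → Fin N × Fin N
    arc (i , j) = if w i j then (i , j) else (j , i)

    block : Edge N → Fin N × ℕ
    block e = proj₁ (arc e) , rank (proj₁ (arc e)) (proj₂ (arc e)) / 2

    Oriented : Edge N → Set
    Oriented (i , j) = i Fin.< j × covers w i j ≡ true

    arc-cases : ∀ e → arc e ≡ e ⊎ arc e ≡ swap e
    arc-cases (i , j) with w i j
    ... | true  = inj₁ refl
    ... | false = inj₂ refl

    arc-isArc : ∀ {e} → Oriented e → w (proj₁ (arc e)) (proj₂ (arc e)) ≡ true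
    arc-isArc {i , j} (_ , ij) with w i j in ij-arc
    ... | true  = ij-arc
    ... | false = ij

    arc-injective : ∀ {e f} → Oriented e → Oriented f → arc e ≡ arc f → e ≡ f
    arc-injective {e} {f} (e< , _) (f< , _) eq with arc-cases e | arc-cases f
    ... | inj₁ e≡ | inj₁ f≡ = trans (sym e≡) (trans eq f≡)
    ... | inj₂ e≡ | inj₂ f≡ = cong swap (trans (sym e≡) (trans eq f≡))
    ... | inj₁ e≡ | inj₂ f≡ with trans (sym e≡) (trans eq f≡)
    ...   | refl = ⊥-elim (FinP.<-asym e< f<)
    arc-injective {e} {f} (e< , _) (f< , _) eq | inj₂ e≡ | inj₁ f≡ with trans (sym e≡) (trans eq f≡)
    ...   | refl = ⊥-elim (FinP.<-asym e< f<)

    block-owner : ∀ e → proj₁ (block e) ≡ proj₁ e ⊎ proj₁ (block e) ≡ proj₂ e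
    block-owner e with arc-cases e
    ... | inj₁ e≡ = inj₁ (cong proj₁ e≡)
    ... | inj₂ e≡ = inj₂ (cong proj₁ e≡)

    block-slot< : ∀ {c} → (∀ x → outdeg w x ≤ 2 * c) → ∀ {e} → Oriented e → proj₂ (block e) < c
    block-slot< {c} outdeg≤2c {e} o =
      m<n*o⇒m/o<n (<-≤-trans (rank<outdeg (arc-isArc o)) (≤-trans (outdeg≤2c _) (≤-reflexive (*-comm 2 c))))

    block-at-most-two : ∀ {e f g} → Oriented e → Oriented f → Oriented g →
                        block e ≡ block f → block e ≡ block g → e ≢ f → e ≢ g → f ≡ g
    block-at-most-two {e} {f} {g} oe of og ef eg e≢f e≢g =
      arc-injective of og (cong₂ _,_ (trans (sym xf) xg) (rank-injective af ag same-rank))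
      where
      x : Fin N
      x = proj₁ (arc e)
      xf : x ≡ proj₁ (arc f)
      xf = ,-injectiveˡ ef
      xg : x ≡ proj₁ (arc g)
      xg = ,-injectiveˡ eg
      ae : w x (proj₂ (arc e)) ≡ true
      ae = arc-isArc oe
      af : w x (proj₂ (arc f)) ≡ true
      af = subst (λ z → w z (proj₂ (arc f)) ≡ true) (sym xf) (arc-isArc of)
      ag : w x (proj₂ (arc g)) ≡ true
      ag = subst (λ z → w z (proj₂ (arc g)) ≡ true) (sym xg) (arc-isArc og)
      half : ∀ {h} → (x≡ : x ≡ proj₁ (arc h)) → proj₂ (block e) ≡ proj₂ (block h) →
             rank x (proj₂ (arc e)) / 2 ≡ rank x (proj₂ (arc h)) / 2
      half {h} x≡ eq = trans eq (cong (λ z → rank z (proj₂ (arc h)) / 2) (sym x≡))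
      distinct : ∀ {h} → Oriented h → (x≡ : x ≡ proj₁ (arc h)) → w x (proj₂ (arc h)) ≡ true → e ≢ h →
                 rank x (proj₂ (arc e)) ≢ rank x (proj₂ (arc h))
      distinct oh x≡ ah e≢h eq = e≢h (arc-injective oe oh (cong₂ _,_ x≡ (rank-injective ae ah eq)))
      same-rank : rank x (proj₂ (arc f)) ≡ rank x (proj₂ (arc g))
      same-rank = /2-at-most-two (half xf (,-injectiveʳ ef)) (half xg (,-injectiveʳ eg))
                                 (distinct of xf af e≢f) (distinct og xg ag e≢g)

module Copies where

  open Counting using (edgesOf-ordered; edgesOf-unique)
  open import Data.Nat using (ℕ; suc; _+_; _*_; _≤_; _<_; z≤n; s≤s)
  open import Data.Nat.Properties using (≤-trans; ≤-reflexive)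
  open import Data.Fin as Fin using (Fin)
  import Data.Fin.Properties as FinP
  open import Data.Bool as Bool using (Bool; true; false; T; if_then_else_)
  open import Data.Bool.Properties using (T-∧; T-≡)
  open import Function.Bundles using (Equivalence)
  open import Data.List as List using (List; []; _∷_; length; filter; allFin; upTo; cartesianProduct)
  import Data.List.Properties as List
  open import Data.List.Membership.Propositional using (_∈_)
  open import Data.List.Membership.Propositional.Properties
    using (∈-filter⁺; ∈-allFin; ∈-upTo⁺; ∈-map⁺; ∈-map⁻; ∈-cartesianProduct⁺)
  open import Data.List.Relation.Unary.Any using (here; there)
  import Data.List.Relation.Unary.All as All
  import Data.List.Relation.Unary.All.Properties as All
  open import Data.List.Relation.Unary.Unique.Propositional using (Unique; []; _∷_)
  open import Data.Product using (_×_; _,_; proj₁; proj₂; swap)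
  open import Data.Product.Properties using (,-injective)
  open import Data.Sum as Sum using (_⊎_; inj₁; inj₂)
  open import Data.Empty using (⊥-elim)
  open import Function using (_∘_)
  open import Relation.Nullary using (does)
  open import Relation.Nullary.Decidable using (dec-true; dec-false)
  open import Relation.Binary.PropositionalEquality

  private
    variable
      A B : Set

  length-cartesianProduct : ∀ (xs : List A) (ys : List B) → length (cartesianProduct xs ys) ≡ length xs * length ys
  length-cartesianProduct []       ys = refl
  length-cartesianProduct (x ∷ xs) ys = trans (List.length-++ (List.map (x ,_) ys))
    (cong₂ _+_ (List.length-map (x ,_) ys) (length-cartesianProduct xs ys))

  remove : ∀ {z : A} (xs : List A) → z ∈ xs → List A
  remove (_ ∷ xs) (here _)  = xs
  remove (x ∷ xs) (there p) = x ∷ remove xs p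

  length-remove : ∀ {z : A} (xs : List A) (p : z ∈ xs) → suc (length (remove xs p)) ≡ length xs
  length-remove (_ ∷ xs) (here _)  = refl
  length-remove (_ ∷ xs) (there p) = cong suc (length-remove xs p)

  ∈-remove : ∀ {z y : A} (xs : List A) (p : z ∈ xs) → y ∈ xs → y ≢ z → y ∈ remove xs p
  ∈-remove (_ ∷ xs) (here refl) (here refl) y≢z = ⊥-elim (y≢z refl)
  ∈-remove (_ ∷ xs) (here refl) (there q)   _   = q
  ∈-remove (_ ∷ xs) (there p)   (here y≡x)  _   = here y≡x
  ∈-remove (_ ∷ xs) (there p)   (there q)   y≢z = there (∈-remove xs p q y≢z)

  length-mono-⊆ : ∀ {xs ys : List A} → Unique xs → (∀ {z} → z ∈ xs → z ∈ ys) → length xs ≤ length ys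
  length-mono-⊆ {xs = []}     _            _  = z≤n
  length-mono-⊆ {xs = x ∷ xs} {ys} (x∉ ∷ u) xs⊆ys =
    ≤-trans (s≤s (length-mono-⊆ u (λ z∈ → ∈-remove ys p (xs⊆ys (there z∈)) (λ z≡x → All.lookup x∉ z∈ (sym z≡x)))))
            (≤-reflexive (length-remove ys p))
    where
    p = xs⊆ys (here refl)

  unique-map : ∀ (f : A → B) {xs} → Unique xs → (∀ {x y} → x ∈ xs → y ∈ xs → f x ≡ f y → x ≡ y) →
               Unique (List.map f xs)
  unique-map f {[]}     _        _   = []
  unique-map f {x ∷ xs} (x∉ ∷ u) inj =
    All.map⁺ (All.tabulate (λ y∈ fx≡fy → All.lookup x∉ y∈ (inj (here refl) (there y∈) fx≡fy)))
    ∷ unique-map f u (λ x∈ y∈ → inj (there x∈) (there y∈))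

  sortPair : ∀ {N} → Fin N → Fin N → Edge N
  sortPair a b = if does (a Fin.<? b) then (a , b) else (b , a)

  sortPair-cases : ∀ {N} (a b : Fin N) → sortPair a b ≡ (a , b) ⊎ sortPair a b ≡ (b , a)
  sortPair-cases a b with does (a Fin.<? b)
  ... | true  = inj₁ refl
  ... | false = inj₂ refl

  sortPair-≡ : ∀ {N} {a b a′ b′ : Fin N} → sortPair a b ≡ sortPair a′ b′ → (a ≡ a′ × b ≡ b′) ⊎ (a ≡ b′ × b ≡ a′)
  sortPair-≡ {a = a} {b} {a′} {b′} eq with sortPair-cases a b | sortPair-cases a′ b′
  ... | inj₁ e | inj₁ e′ = inj₁ (,-injective (trans (sym e) (trans eq e′)))
  ... | inj₂ e | inj₂ e′ = inj₁ (swap (,-injective (trans (sym e) (trans eq e′))))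
  ... | inj₁ e | inj₂ e′ = inj₂ (,-injective (trans (sym e) (trans eq e′)))
  ... | inj₂ e | inj₁ e′ = inj₂ (swap (,-injective (trans (sym e) (trans eq e′))))

  sortPair-endpoints : ∀ {N} (a b : Fin N) {x} → x ≡ proj₁ (sortPair a b) ⊎ x ≡ proj₂ (sortPair a b) → x ≡ a ⊎ x ≡ b
  sortPair-endpoints a b x∈ with sortPair-cases a b
  ... | inj₁ eq = Sum.map (λ p → trans p (cong proj₁ eq)) (λ p → trans p (cong proj₂ eq)) x∈
  ... | inj₂ eq = Sum.swap (Sum.map (λ p → trans p (cong proj₁ eq)) (λ p → trans p (cong proj₂ eq)) x∈)

  OnePerBlock : ∀ {n} {B : Set} → (Edge n → B) → List (Edge n) → Set
  OnePerBlock block M = ∀ {e f} → e ∈ M → f ∈ M → block e ≡ block f → e ≡ f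

  -- A copy of S in M sends each edge of S to the block of its image, a pair (vertex of S, slot < c);
  -- with one edge of M per block this map is injective.
  module _ (H G : Graph) (c : ℕ) (block : Edge (n G) → Fin (n G) × ℕ)
           (block-owner : ∀ e → proj₁ (block e) ≡ proj₁ e ⊎ proj₁ (block e) ≡ proj₂ e)
           (block-slot< : ∀ {e} → e ∈ edges G → proj₂ (block e) < c) where

    copy⇒sparse : ∀ (M : List (Edge (n G))) → (∀ {e} → e ∈ M → e ∈ edges G) →
                  OnePerBlock block M → ContainsCopy H G M → (S : Subgraph H) → ecount S ≤ vcount S * c
    copy⇒sparse M M⊆E distinct (φ , φ-inj , copy) S =
      ≤-trans (≤-reflexive (sym (List.length-map (block ∘ image) S-edges)))
              (≤-trans (length-mono-⊆ (unique-map (block ∘ image) (edgesOf-unique _ (es S)) injective) blocks⊆slots)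
                       (≤-reflexive (trans (length-cartesianProduct (List.map φ S-vertices) (upTo c))
                                           (cong₂ _*_ (List.length-map φ S-vertices) (List.length-upTo c)))))
      where
      S-edges : List (Edge (n H))
      S-edges = edgesOf (n H) (es S)
      S-vertices : List (Fin (n H))
      S-vertices = filter (λ x → vs S x Bool.≟ true) (allFin (n H))

      S-edge : ∀ {u v} → (u , v) ∈ S-edges → u Fin.< v × T (adj H u v) × vs S u ≡ true × vs S v ≡ true
      S-edge {u} {v} uv∈ with edgesOf-ordered (n H) (es S) uv∈
      ... | u<v , uv-es with Equivalence.to T-∧ (es-⊆ S u v (Equivalence.from T-≡ uv-es))
      ...   | adj-uv , u∧v with Equivalence.to T-∧ u∧v
      ...     | u∈S , v∈S = u<v , adj-uv , Equivalence.to T-≡ u∈S , Equivalence.to T-≡ v∈S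

      image : Edge (n H) → Edge (n G)
      image (u , v) = sortPair (φ u) (φ v)

      sortPair∈M : ∀ a b → (a , b) ∈ M ⊎ (b , a) ∈ M → sortPair a b ∈ M
      sortPair∈M a b (inj₁ ab∈M) rewrite dec-true (a Fin.<? b) (proj₁ (edgesOf-ordered _ (adj G) (M⊆E ab∈M))) = ab∈M
      sortPair∈M a b (inj₂ ba∈M)
        rewrite dec-false (a Fin.<? b) (FinP.<-asym (proj₁ (edgesOf-ordered _ (adj G) (M⊆E ba∈M)))) = ba∈M

      image∈M : ∀ {e} → e ∈ S-edges → image e ∈ M
      image∈M {u , v} e∈ = sortPair∈M (φ u) (φ v) (copy u v (proj₁ (proj₂ (S-edge e∈))))

      injective : ∀ {e f} → e ∈ S-edges → f ∈ S-edges → block (image e) ≡ block (image f) → e ≡ f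
      injective {u , v} {u′ , v′} e∈ f∈ same-block with sortPair-≡ (distinct (image∈M e∈) (image∈M f∈) same-block)
      ... | inj₁ (uu′ , vv′) = cong₂ _,_ (φ-inj uu′) (φ-inj vv′)
      ... | inj₂ (uv′ , vu′) with φ-inj uv′ | φ-inj vu′
      ...   | refl | refl = ⊥-elim (FinP.<-asym (proj₁ (S-edge e∈)) (proj₁ (S-edge f∈)))

      slots : List (Fin (n G) × ℕ)
      slots = cartesianProduct (List.map φ S-vertices) (upTo c)

      vertex : ∀ {x} → vs S x ≡ true → φ x ∈ List.map φ S-vertices
      vertex {x} x∈S = ∈-map⁺ φ (∈-filter⁺ (λ y → vs S y Bool.≟ true) (∈-allFin x) x∈S)

      owner∈S : ∀ {e} → e ∈ S-edges → proj₁ (block (image e)) ∈ List.map φ S-vertices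
      owner∈S {u , v} e∈ with S-edge e∈ | sortPair-endpoints (φ u) (φ v) (block-owner (image (u , v)))
      ... | _ , _ , u∈S , _ | inj₁ owner≡u = subst (_∈ _) (sym owner≡u) (vertex u∈S)
      ... | _ , _ , _ , v∈S | inj₂ owner≡v = subst (_∈ _) (sym owner≡v) (vertex v∈S)

      blocks⊆slots : ∀ {b} → b ∈ List.map (block ∘ image) S-edges → b ∈ slots
      blocks⊆slots b∈ with ∈-map⁻ (block ∘ image) b∈
      ... | e , e∈ , refl = ∈-cartesianProduct⁺ (owner∈S e∈) (∈-upTo⁺ (block-slot< (M⊆E (image∈M e∈))))

module Game where

  open Counting using (edgesOf-unique)
  open Copies using (OnePerBlock)
  open import Data.Nat using (zero; suc)
  open import Data.Fin as Fin using (Fin; zero; suc; punchIn)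
  import Data.Fin.Properties as FinP
  open import Data.List as List using (List; []; _∷_)
  open import Data.List.Membership.Propositional using (_∈_)
  open import Data.List.Relation.Unary.Any using (here; there)
  import Data.List.Relation.Unary.All as All
  open import Data.List.Relation.Unary.Unique.Propositional using (Unique; _∷_)
  open import Data.Vec as Vec using (Vec; lookup; removeAt; fromList)
  import Data.Vec.Properties as Vec
  open import Data.Product using (Σ; _×_; _,_; proj₁; proj₂)
  open import Data.Product.Properties using (≡-dec)
  open import Data.Empty using (⊥-elim)
  open import Function using (_∘_)
  open import Relation.Nullary using (yes; no; ¬_)
  open import Relation.Binary using (DecidableEquality)
  open import Relation.Binary.PropositionalEquality

  module _ {A : Set} where

    _∈ᵛ_ : ∀ {k} → A → Vec A k → Set
    _∈ᵛ_ {k} x U = Σ (Fin k) λ i → lookup U i ≡ x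

    Distinct : ∀ {k} → Vec A k → Set
    Distinct U = ∀ {i j} → lookup U i ≡ lookup U j → i ≡ j

    lookup-removeAt : ∀ {k} (U : Vec A (suc k)) i j → lookup (removeAt U i) j ≡ lookup U (punchIn i j)
    lookup-removeAt U i j = trans (cong (lookup (removeAt U i)) (sym (FinP.punchOut-punchIn i)))
                                  (Vec.removeAt-punchOut U (FinP.punchInᵢ≢i i j ∘ sym))

    removeAt-⊆ : ∀ {k} (U : Vec A (suc k)) i {x} → x ∈ᵛ removeAt U i → x ∈ᵛ U
    removeAt-⊆ U i (j , eq) = punchIn i j , trans (sym (lookup-removeAt U i j)) eq

    lookup∉removeAt : ∀ {k} (U : Vec A (suc k)) i → Distinct U → ¬ (lookup U i ∈ᵛ removeAt U i)
    lookup∉removeAt U i distinct (j , eq) = FinP.punchInᵢ≢i i j (distinct (trans (sym (lookup-removeAt U i j)) eq))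

    removeAt-distinct : ∀ {k} (U : Vec A (suc k)) i → Distinct U → Distinct (removeAt U i)
    removeAt-distinct U i distinct {a} {b} eq =
      FinP.punchIn-injective i a b (distinct (trans (sym (lookup-removeAt U i a)) (trans eq (lookup-removeAt U i b))))

    lookup-fromList-∈ : ∀ (xs : List A) i → lookup (fromList xs) i ∈ xs
    lookup-fromList-∈ (x ∷ xs) zero    = here refl
    lookup-fromList-∈ (x ∷ xs) (suc i) = there (lookup-fromList-∈ xs i)

    fromList-distinct : ∀ {xs : List A} → Unique xs → Distinct (fromList xs)
    fromList-distinct {x ∷ xs} (x∉ ∷ u) {zero}  {zero}  _  = refl
    fromList-distinct {x ∷ xs} (x∉ ∷ u) {zero}  {suc j} eq = ⊥-elim (All.lookup x∉ (lookup-fromList-∈ xs j) eq)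
    fromList-distinct {x ∷ xs} (x∉ ∷ u) {suc i} {zero}  eq = ⊥-elim (All.lookup x∉ (lookup-fromList-∈ xs i) (sym eq))
    fromList-distinct {x ∷ xs} (x∉ ∷ u) {suc i} {suc j} eq = cong suc (fromList-distinct u eq)

  -- Breaker's pairing strategy: whenever Maker claims an edge, Breaker claims the other unclaimed
  -- edge of its block, if there is one.  Then Maker never owns two edges of one block.
  module PairingStrategy (H G : Graph) {B : Set} (_≟B_ : DecidableEquality B) (block : Edge (n G) → B)
    (at-most-two : ∀ {e f g} → e ∈ edges G → f ∈ edges G → g ∈ edges G →
                   block e ≡ block f → block e ≡ block g → e ≢ f → e ≢ g → f ≡ g)
    (no-copy : ∀ M → (∀ {m} → m ∈ M → m ∈ edges G) → OnePerBlock block M → ¬ ContainsCopy H G M) where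

    private
      Ed : Set
      Ed = Edge (n G)

    record Invariant {k} (U : Vec Ed k) (M : List Ed) : Set where
      field
        distinct : Distinct U
        U⊆E : ∀ {x} → x ∈ᵛ U → x ∈ edges G
        M⊆E : ∀ {m} → m ∈ M → m ∈ edges G
        partner-taken : ∀ {m g} → m ∈ M → block g ≡ block m → g ≢ m → ¬ g ∈ᵛ U × ¬ g ∈ M
    open Invariant

    _≟E_ : DecidableEquality Ed
    _≟E_ = ≡-dec Fin._≟_ Fin._≟_

    onePerBlock : ∀ {k} {U : Vec Ed k} {M} → Invariant U M → OnePerBlock block M
    onePerBlock inv {e} {f} e∈ f∈ same with e ≟E f
    ... | yes e≡f = e≡f
    ... | no  e≢f = ⊥-elim (proj₂ (partner-taken inv f∈ same e≢f) e∈)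

    onePerBlock-∷ : ∀ {k} {U : Vec Ed k} {M e} → Invariant U M → e ∈ᵛ U → OnePerBlock block (e ∷ M)
    onePerBlock-∷ inv e∈U (here refl) (here refl) _    = refl
    onePerBlock-∷ inv e∈U (here refl) (there f∈) same with _ ≟E _
    ... | yes e≡f = e≡f
    ... | no  e≢f = ⊥-elim (proj₁ (partner-taken inv f∈ same e≢f) e∈U)
    onePerBlock-∷ inv e∈U (there e∈) (here refl) same with _ ≟E _
    ... | yes f≡e = sym f≡e
    ... | no  f≢e = ⊥-elim (proj₁ (partner-taken inv e∈ (sym same) f≢e) e∈U)
    onePerBlock-∷ inv e∈U (there e∈) (there f∈) same = onePerBlock inv e∈ f∈ same

    ∷-⊆E : ∀ {k} {U : Vec Ed k} {M e} → Invariant U M → e ∈ᵛ U → ∀ {m} → m ∈ e ∷ M → m ∈ edges G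
    ∷-⊆E inv e∈U (here refl) = U⊆E inv e∈U
    ∷-⊆E inv e∈U (there m∈) = M⊆E inv m∈

    data Partner {k} (U : Vec Ed k) (e : Ed) : Set where
      found : ∀ j → block (lookup U j) ≡ block e → Partner U e
      none  : (∀ j → block (lookup U j) ≢ block e) → Partner U e

    partner : ∀ {k} (U : Vec Ed k) e → Partner U e
    partner U e with FinP.any? (λ j → block (lookup U j) ≟B block e)
    ... | yes (j , same) = found j same
    ... | no  no-partner = none (λ j same → no-partner (j , same))

    module Answer {k} {U : Vec Ed (suc (suc k))} {M} (inv : Invariant U M) (i : Fin (suc (suc k))) where

      e : Ed
      e = lookup U i
      U₁ : Vec Ed (suc k)
      U₁ = removeAt U i

      e∈U : e ∈ᵛ U
      e∈U = i , refl

      e∉U₁ : ¬ e ∈ᵛ U₁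
      e∉U₁ = lookup∉removeAt U i (distinct inv)

      reply : Partner U₁ e → Fin (suc k)
      reply (found j _) = j
      reply (none _)    = zero

      partner-gone : ∀ p {g} → block g ≡ block e → g ≢ e → ¬ g ∈ᵛ removeAt U₁ (reply p)
      partner-gone (found j same) {g} g-same g≢e g∈ =
        lookup∉removeAt U₁ j (removeAt-distinct U i (distinct inv)) (subst (_∈ᵛ removeAt U₁ j) (sym f≡g) g∈)
        where
        f : Ed
        f = lookup U₁ j
        f≡g : f ≡ g
        f≡g = at-most-two (U⊆E inv e∈U) (U⊆E inv (removeAt-⊆ U i (j , refl)))
                          (U⊆E inv (removeAt-⊆ U i (removeAt-⊆ U₁ j g∈)))
                          (sym same) (sym g-same) (λ e≡f → e∉U₁ (j , sym e≡f)) (g≢e ∘ sym)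
      partner-gone (none no-partner) g-same g≢e g∈ with removeAt-⊆ U₁ zero g∈
      ... | j , eq = no-partner j (trans (cong block eq) g-same)

      invariant : ∀ p → Invariant (removeAt U₁ (reply p)) (e ∷ M)
      invariant p = record
        { distinct = removeAt-distinct U₁ (reply p) (removeAt-distinct U i (distinct inv))
        ; U⊆E = U⊆E inv ∘ shrink
        ; M⊆E = ∷-⊆E inv e∈U
        ; partner-taken = taken }
        where
        shrink : ∀ {x} → x ∈ᵛ removeAt U₁ (reply p) → x ∈ᵛ U
        shrink = removeAt-⊆ U i ∘ removeAt-⊆ U₁ (reply p)
        taken : ∀ {m g} → m ∈ e ∷ M → block g ≡ block m → g ≢ m → ¬ g ∈ᵛ removeAt U₁ (reply p) × ¬ g ∈ e ∷ M
        taken (here refl) same g≢e = partner-gone p same g≢e , λ where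
          (here g≡e) → g≢e g≡e
          (there g∈M) → proj₁ (partner-taken inv g∈M (sym same) (g≢e ∘ sym)) e∈U
        taken (there m∈M) same g≢m with partner-taken inv m∈M same g≢m
        ... | ∉U , ∉M = ∉U ∘ shrink , λ where
          (here refl) → ∉U e∈U
          (there g∈M) → ∉M g∈M

    mutual
      makerMoves : ∀ k (U : Vec Ed k) M → Invariant U M → BreakerWinsM H G k U M
      makerMoves zero    U M inv   = no-copy M (M⊆E inv) (onePerBlock inv)
      makerMoves (suc k) U M inv i = breakerMoves k U M inv i

      breakerMoves : ∀ k (U : Vec Ed (suc k)) M → Invariant U M → (i : Fin (suc k)) →
                     BreakerWinsB H G k (removeAt U i) (lookup U i ∷ M)
      breakerMoves zero     U M inv i = no-copy (lookup U i ∷ M) (∷-⊆E inv (i , refl)) (onePerBlock-∷ inv (i , refl))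
      breakerMoves (suc k) U M inv i = A.reply p , makerMoves k _ _ (A.invariant p)
        where
        module A = Answer inv i
        p : Partner A.U₁ A.e
        p = partner A.U₁ A.e

    breakerWins : BreakerWinsMakerFirst H G
    breakerWins = makerMoves _ (fromList (edges G)) [] record
      { distinct = fromList-distinct (edgesOf-unique (n G) (adj G))
      ; U⊆E = λ { (i , refl) → lookup-fromList-∈ (edges G) i }
      ; M⊆E = λ ()
      ; partner-taken = λ () }

open Counting
open Density
open Orientation
open Copies
open Game
open import Data.Nat as ℕ using (ℕ; NonZero)
open import Data.Rational using (ℚ; _<_; _/_; _*_; ½; ceiling)
import Data.Nat.Properties as ℕ
open import Data.Fin as Fin using (Fin)
open import Data.Bool as Bool using (Bool; true; false; _∧_)
import Data.Bool.Properties as Bool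
open import Data.List.Membership.Propositional using (_∈_)
open import Data.Product using (Σ; _×_; _,_)
open import Data.Product.Properties using (≡-dec)
open import Relation.Binary.PropositionalEquality

induced : (G : Graph) → (Fin (n G) → Bool) → Subgraph G
induced G R = record
  { vs = R
  ; es = λ i j → adj G i j ∧ R i ∧ R j
  ; es-sym = λ i j → cong₂ _∧_ (adj-sym G i j) (Bool.∧-comm (R i) (R j))
  ; es-⊆ = λ _ _ e → e }

pairCount-induced : ∀ G R → 2 ℕ.* ecount (induced G R) ≡ pairCount (n G) (λ i j → adj G i j ∧ R i ∧ R j)
pairCount-induced G R = handshake _ (λ i j → cong₂ _∧_ (adj-sym G i j) (Bool.∧-comm (R i) (R j))) irrefl
  where
  irrefl : ∀ i → adj G i i ∧ R i ∧ R i ≡ false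
  irrefl i rewrite adj-irrefl G i = refl

induced-nonZero : ∀ G {R u} → R u ≡ true → NonZero (vcount (induced G R))
induced-nonZero G {R} {u} u∈R = ℕ.>-nonZero (ℕ.<-≤-trans (subst (λ b → 0 ℕ.< ⟦ b ⟧) (sym u∈R) (ℕ.s≤s ℕ.z≤n))
  (ℕ.≤-trans (≤-sum (λ i → ⟦ R i ⟧) u) (ℕ.≤-reflexive (sym (count-allFin (n G) R)))))

sparse⇒orientable : ∀ G K → (∀ (S : Subgraph G) → NonZero (vcount S) → ecount S ℕ.≤ K ℕ.* vcount S) →
  Σ (Arcs (n G)) λ w → (∀ x → outdeg w x ℕ.≤ K) × (∀ i j → adj G i j ≡ true → covers w i j ≡ true)
sparse⇒orientable G K G-sparse =
  let w , o , covered = Hakimi.orientation (n G) (adj G) (adj-sym G) (adj-irrefl G) K induced-sparse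
  in w , Hakimi.IsOrientation.outdeg≤K o , covered
  where
  induced-sparse : ∀ (R : Fin (n G) → Bool) u → R u ≡ true →
                   pairCount (n G) (λ i j → adj G i j ∧ R i ∧ R j) ℕ.≤ 2 ℕ.* (K ℕ.* ∑[ i < n G ] ⟦ R i ⟧)
  induced-sparse R u u∈R =
    ℕ.≤-trans (ℕ.≤-reflexive (sym (pairCount-induced G R)))
              (ℕ.*-monoʳ-≤ 2 (ℕ.≤-trans (G-sparse (induced G R) (induced-nonZero G u∈R))
                                        (ℕ.≤-reflexive (cong (K ℕ.*_) (count-allFin (n G) R)))))

breakerWins-if-orientable : ∀ G H c (w : Arcs (n G)) → (∀ x → outdeg w x ℕ.≤ 2 ℕ.* c) →
  (∀ i j → adj G i j ≡ true → covers w i j ≡ true) →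
  Σ (Subgraph H) (λ S → c ℕ.* vcount S ℕ.< ecount S) →
  BreakerWinsMakerFirst H G
breakerWins-if-orientable G H c w outdeg≤2c covered (S , S-dense) =
  PairingStrategy.breakerWins H G (≡-dec Fin._≟_ ℕ._≟_) block
    (λ e∈ f∈ g∈ → block-at-most-two (oriented e∈) (oriented f∈) (oriented g∈))
    (λ M M⊆E one copy → ℕ.<⇒≱ S-dense (ℕ.≤-trans (maker-sparse M M⊆E one copy S)
                                                 (ℕ.≤-reflexive (ℕ.*-comm (vcount S) c))))
  where
  open Pairing.Blocks w
  oriented : ∀ {e} → e ∈ edges G → Oriented e
  oriented e∈ with edgesOf-ordered (n G) (adj G) e∈
  ... | i<j , ij = i<j , covered _ _ ij
  maker-sparse : ∀ M → (∀ {m} → m ∈ M → m ∈ edges G) → OnePerBlock block M → ContainsCopy H G M →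
                 (S : Subgraph H) → ecount S ℕ.≤ vcount S ℕ.* c
  maker-sparse = copy⇒sparse H G c block block-owner (λ e∈ → block-slot< outdeg≤2c (oriented e∈))

proposition17 : (G H : Graph) (mG mH : ℚ) →
    IsMaxDensity G mG → IsMaxDensity H mH →
    (ceiling (mG * ½)) / 1 < mH →
    BreakerWinsMakerFirst H G
proposition17 G H mG mH maxG maxH ⌈mG/2⌉<mH =
  let c , ⌈mG/2⌉≡c , G-sparse = maxDensity⇒sparse maxG
      w , outdeg≤2c , covered = sparse⇒orientable G (2 ℕ.* c) G-sparse
  in breakerWins-if-orientable G H c w outdeg≤2c covered
       (maxDensity⇒dense c maxH (subst (λ z → z / 1 < mH) ⌈mG/2⌉≡c ⌈mG/2⌉<mH))
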